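{- Let $n\ge 0$ and let $Z_n$ be the number of zeros of a random lattice path $W_n$ of length $n$ (as described in the context). Then $\mathbb{E}[Z_n]=H^{\mathrm{odd}}_{n+1}$, where $H^{\mathrm{odd}}_m=\sum_{j=1}^m\frac{[j\text{ odd}]}{j}$.
   Context: Random lattice path model: a path $W_n$ of length $n$ starts at $(0,0)$ and uses steps $(1,+1)$ and $(1,-1)$. First an endpoint $(n,D)$ is chosen with $D$ uniformly distributed on $\{ -n,-n+2,\dots,n-2,n\}$; then a path is chosen uniformly at random among all paths from $(0,0)$ to $(n,D)$. A zero of the path is a point $(x,0)$ on it (including the origin). $[P]=1$ if $P$ is true and $0$ otherwise. -}

module Defs where

open import Data.Bool using (Bool; true; false; if_then_else_)
open import Data.Nat as ℕ using (ℕ; zero; suc)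
open import Data.Integer as ℤ using (ℤ; +_)
open import Data.Rational as ℚ using (ℚ; 0ℚ)
open import Data.List as List using (List; []; _∷_; map; filter; length)
open import Data.Vec as Vec using (Vec; []; _∷_)
open import Relation.Binary.PropositionalEquality using (_≡_)
open import Relation.Nullary.Decidable using (⌊_⌋)

-- A lattice path of length n: a sequence of n steps, true = (1,+1), false = (1,-1).
Path : ℕ → Set
Path n = Vec Bool n

allPaths : (n : ℕ) → List (Path n)
allPaths zero = [] ∷ []
allPaths (suc n) = List.map (true ∷_) (allPaths n) List.++ List.map (false ∷_) (allPaths n)

step : Bool → ℤ
step true = ℤ.+ 1
step false = ℤ.- (ℤ.+ 1)

zerosFrom : ∀ {n} → ℤ → Path n → ℕ
zerosFrom h [] = if ⌊ h ℤ.≟ ℤ.0ℤ ⌋ then 1 else 0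
zerosFrom h (b ∷ p) = (if ⌊ h ℤ.≟ ℤ.0ℤ ⌋ then 1 else 0) ℕ.+ zerosFrom (h ℤ.+ step b) p

zeros : ∀ {n} → Path n → ℕ
zeros = zerosFrom ℤ.0ℤ

endHeight : ∀ {n} → Path n → ℤ
endHeight [] = ℤ.0ℤ
endHeight (b ∷ p) = step b ℤ.+ endHeight p

endpoints : ℕ → List ℤ
endpoints n = map (λ k → (ℤ.+ (2 ℕ.* k)) ℤ.- (ℤ.+ n)) (List.upTo (suc n))

pathsTo : (n : ℕ) → ℤ → List (Path n)
pathsTo n D = filter (λ p → endHeight p ℤ.≟ D) (allPaths n)

-- Division of naturals into ℚ (returns 0 for divisor 0; never used with divisor 0 here,
-- since every endpoint in `endpoints n` is reached by at least one path).
_÷ℕ_ : ℕ → ℕ → ℚ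
a ÷ℕ zero = 0ℚ
a ÷ℕ (suc d) = (ℤ.+ a) ℚ./ suc d

sumℚ : List ℚ → ℚ
sumℚ = List.foldr ℚ._+_ 0ℚ

sumℕ : List ℕ → ℕ
sumℕ = List.foldr ℕ._+_ 0

-- E[Z_n]: D uniform on the n+1 endpoints, then a uniform path among those ending at (n,D).
-- E[Z_n] = Σ_D (1/(n+1)) · (Σ_{p ∈ pathsTo n D} zeros p) / #(pathsTo n D).
expectedZeros : ℕ → ℚ
expectedZeros n =
  sumℚ (map (λ D → (1 ÷ℕ suc n) ℚ.* (sumℕ (map zeros (pathsTo n D)) ÷ℕ length (pathsTo n D)))
            (endpoints n))

oddInd : ℕ → ℕ
oddInd zero = 0
oddInd (suc zero) = 1
oddInd (suc (suc j)) = oddInd j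

Hodd : ℕ → ℚ
Hodd zero = 0ℚ
Hodd (suc m) = Hodd m ℚ.+ (oddInd (suc m) ÷ℕ suc m)

-- Give a path with k up-steps the weight k! (n - k)!. The C(n,k) paths ending at height 2k - n
-- then have total weight n!, so choosing the endpoint uniformly and then a path uniformly among
-- those reaching it draws each path p with probability weight(p) / (n+1)!. Hence
-- (n+1)! E[Z_n] = Σ_p weight(p) Z(p) = Σ_m W_m, where W_m is the total weight of the paths
-- through (2m, 0). Splitting such a path after its first 2m steps gives
-- W_m = C(2m,m) Σ_j C(N,j) (m+j)! (m+N-j)! with N = n - 2m, and a Beta-integral identity turns
-- this into (n+1)! / (2m+1). Summing over 2m ≤ n gives (n+1)! H^odd_{n+1}.
module Submission where

open import Data.Bool using (Bool; true; false; if_then_else_)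
open import Data.Nat as ℕ using (ℕ; zero; suc; _+_; _*_; _∸_; _!; _≤_; _<_; z≤n; s≤s)
open import Data.Nat.Properties
open import Data.Nat.ListAction.Properties using (sum-++)
open import Data.Nat.Tactic.RingSolver using (solve-∀)
open import Data.Integer as ℤ using (ℤ; -[1+_])
open import Data.Integer.Properties as ℤ using (pos-+; pos-*)
import Data.Integer.Tactic.RingSolver as ℤ-Solver
open import Data.Rational as ℚ using (ℚ; fromℚᵘ)
open import Data.Rational.Properties as ℚ
  using (toℚᵘ-injective; toℚᵘ-fromℚᵘ; toℚᵘ-homo-+; toℚᵘ-homo-*; fromℚᵘ-cong)
open import Data.Rational.Unnormalised as ℚᵘ using (mkℚᵘ; *≡*)
open import Data.Rational.Unnormalised.Properties as ℚᵘ using (≃-trans; ≃-sym)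
open import Data.List as List using ([]; _∷_; map; filter; length; applyUpTo)
open import Data.List.Properties using (map-++; map-∘; map-upTo)
open import Data.Vec using ([]; _∷_)
open import Function using (_∘_)
open import Function.Bundles using (mk⇔)
open import Relation.Binary.PropositionalEquality
open import Relation.Binary.Definitions using (tri<; tri≈; tri>)
open import Relation.Nullary using (Dec; does; yes; no)
open import Relation.Nullary.Decidable using (dec-true; dec-false; does-⇔)
open import Algebra.Properties.CommutativeSemigroup +-commutativeSemigroup
  using () renaming (interchange to +-interchange)
open import Algebra.Properties.CommutativeSemigroup *-commutativeSemigroup
  using () renaming (x∙yz≈y∙xz to *-leftComm)

open import Defs

open ≡-Reasoning

indicator : Bool → ℕ
indicator b = if b then 1 else 0

δ : ℕ → ℕ → ℕ
δ m n = indicator (does (m ℕ.≟ n))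

δ-refl : ∀ n → δ n n ≡ 1
δ-refl n = cong indicator (dec-true (n ℕ.≟ n) refl)

δ-≢ : ∀ {m n} → m ≢ n → δ m n ≡ 0
δ-≢ {m} {n} m≢n = cong indicator (dec-false (m ℕ.≟ n) m≢n)

module _ {A : Set} where

  sum-map-cong : ∀ {f g : A → ℕ} xs → (∀ x → f x ≡ g x) → sumℕ (map f xs) ≡ sumℕ (map g xs)
  sum-map-cong []       f≗g = refl
  sum-map-cong (x ∷ xs) f≗g = cong₂ _+_ (f≗g x) (sum-map-cong xs f≗g)

  sum-map-zero : ∀ {f : A → ℕ} xs → (∀ x → f x ≡ 0) → sumℕ (map f xs) ≡ 0
  sum-map-zero []       f≗0 = refl
  sum-map-zero (x ∷ xs) f≗0 = cong₂ _+_ (f≗0 x) (sum-map-zero xs f≗0)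

  sum-map-*ˡ : ∀ c (f : A → ℕ) xs → sumℕ (map (λ x → c * f x) xs) ≡ c * sumℕ (map f xs)
  sum-map-*ˡ c f []       = sym (*-zeroʳ c)
  sum-map-*ˡ c f (x ∷ xs) =
    trans (cong (c * f x +_) (sum-map-*ˡ c f xs)) (sym (*-distribˡ-+ c (f x) _))

  sum-map-filter : ∀ {P : A → Set} (P? : ∀ x → Dec (P x)) (f : A → ℕ) xs →
                   sumℕ (map f (filter P? xs)) ≡ sumℕ (map (λ x → indicator (does (P? x)) * f x) xs)
  sum-map-filter P? f []       = refl
  sum-map-filter P? f (x ∷ xs) with does (P? x)
  ... | true  = cong₂ _+_ (sym (+-identityʳ (f x))) (sum-map-filter P? f xs)
  ... | false = sum-map-filter P? f xs

  length-filter : ∀ {P : A → Set} (P? : ∀ x → Dec (P x)) xs →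
                  length (filter P? xs) ≡ sumℕ (map (λ x → indicator (does (P? x))) xs)
  length-filter P? []       = refl
  length-filter P? (x ∷ xs) with does (P? x)
  ... | true  = cong suc (length-filter P? xs)
  ... | false = length-filter P? xs

∑≤ : ℕ → (ℕ → ℕ) → ℕ
∑≤ zero    f = f 0
∑≤ (suc n) f = f 0 + ∑≤ n (f ∘ suc)

syntax ∑≤ n (λ m → e) = ∑[ m ≤ n ] e

∑≤-cong : ∀ n {f g : ℕ → ℕ} → (∀ m → f m ≡ g m) → ∑≤ n f ≡ ∑≤ n g
∑≤-cong zero    f≗g = f≗g 0
∑≤-cong (suc n) f≗g = cong₂ _+_ (f≗g 0) (∑≤-cong n (f≗g ∘ suc))

∑≤-last : ∀ n (f : ℕ → ℕ) → ∑≤ (suc n) f ≡ ∑≤ n f + f (suc n)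
∑≤-last zero    f = refl
∑≤-last (suc n) f = trans (cong (f 0 +_) (∑≤-last n (f ∘ suc))) (sym (+-assoc (f 0) _ _))

∑≤-zero : ∀ n → ∑[ m ≤ n ] 0 ≡ 0
∑≤-zero zero    = refl
∑≤-zero (suc n) = ∑≤-zero n

∑≤-head : ∀ n (f : ℕ → ℕ) → (∀ m → f (suc m) ≡ 0) → ∑≤ n f ≡ f 0
∑≤-head zero    f tail≗0 = refl
∑≤-head (suc n) f tail≗0 =
  trans (cong (f 0 +_) (trans (∑≤-cong n tail≗0) (∑≤-zero n))) (+-identityʳ (f 0))

∑≤-+ : ∀ n (f g : ℕ → ℕ) → ∑[ m ≤ n ] (f m + g m) ≡ ∑≤ n f + ∑≤ n g
∑≤-+ zero    f g = refl
∑≤-+ (suc n) f g = trans (cong (f 0 + g 0 +_) (∑≤-+ n (f ∘ suc) (g ∘ suc))) (+-interchange (f 0) (g 0) _ _)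

∑≤-*ˡ : ∀ n c (f : ℕ → ℕ) → ∑[ m ≤ n ] (c * f m) ≡ c * ∑≤ n f
∑≤-*ˡ zero    c f = refl
∑≤-*ˡ (suc n) c f = trans (cong (c * f 0 +_) (∑≤-*ˡ n c (f ∘ suc))) (sym (*-distribˡ-+ c (f 0) _))

∑≤-δ : ∀ n {u} → u ≤ n → ∑[ k ≤ n ] δ u k ≡ 1
∑≤-δ zero    z≤n       = refl
∑≤-δ (suc n) z≤n       = cong suc (∑≤-zero n)
∑≤-δ (suc n) (s≤s u≤n) = ∑≤-δ n u≤n

sum-map-∑≤ : ∀ {A : Set} n (g : A → ℕ → ℕ) xs →
             sumℕ (map (λ x → ∑≤ n (g x)) xs) ≡ ∑[ m ≤ n ] sumℕ (map (λ x → g x m) xs)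
sum-map-∑≤ n g []       = sym (∑≤-zero n)
sum-map-∑≤ n g (x ∷ xs) =
  trans (cong (∑≤ n (g x) +_) (sum-map-∑≤ n g xs)) (sym (∑≤-+ n (g x) _))

ups : ∀ {n} → Path n → ℕ
ups []          = 0
ups (true ∷ p)  = suc (ups p)
ups (false ∷ p) = ups p

downs : ∀ {n} → Path n → ℕ
downs []          = 0
downs (true ∷ p)  = downs p
downs (false ∷ p) = suc (downs p)

ups+downs≡length : ∀ {n} (p : Path n) → ups p + downs p ≡ n
ups+downs≡length []          = refl
ups+downs≡length (true ∷ p)  = cong suc (ups+downs≡length p)
ups+downs≡length (false ∷ p) = trans (+-suc (ups p) (downs p)) (cong suc (ups+downs≡length p))

ups≤length : ∀ {n} (p : Path n) → ups p ≤ n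
ups≤length p = subst (ups p ≤_) (ups+downs≡length p) (m≤m+n (ups p) (downs p))

sum-allPaths-suc : ∀ n (f : Path (suc n) → ℕ) →
                   sumℕ (map f (allPaths (suc n))) ≡
                   sumℕ (map (f ∘ (true ∷_)) (allPaths n)) + sumℕ (map (f ∘ (false ∷_)) (allPaths n))
sum-allPaths-suc n f = begin
  sumℕ (map f (map (true ∷_) ps List.++ map (false ∷_) ps))
    ≡⟨ cong sumℕ (map-++ f (map (true ∷_) ps) _) ⟩
  sumℕ (map f (map (true ∷_) ps) List.++ map f (map (false ∷_) ps))
    ≡⟨ sum-++ (map f (map (true ∷_) ps)) _ ⟩
  sumℕ (map f (map (true ∷_) ps)) + sumℕ (map f (map (false ∷_) ps))
    ≡⟨ cong₂ (λ xs ys → sumℕ xs + sumℕ ys) (sym (map-∘ ps)) (sym (map-∘ ps)) ⟩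
  sumℕ (map (f ∘ (true ∷_)) ps) + sumℕ (map (f ∘ (false ∷_)) ps) ∎
  where ps = allPaths n

-- passes x y p = 1 iff p passes through (x + y, x - y), i.e. its first x + y steps are x up-steps
-- and y down-steps in some order; otherwise 0.
passes : ∀ {n} → ℕ → ℕ → Path n → ℕ
passes zero    zero    p           = 1
passes zero    (suc y) []          = 0
passes zero    (suc y) (true ∷ p)  = 0
passes zero    (suc y) (false ∷ p) = passes zero y p
passes (suc x) y       []          = 0
passes (suc x) y       (true ∷ p)  = passes x y p
passes (suc x) zero    (false ∷ p) = 0
passes (suc x) (suc y) (false ∷ p) = passes (suc x) y p

passes-tooLong : ∀ {n} x y (p : Path n) → n < x + y → passes x y p ≡ 0
passes-tooLong zero    zero    p           ()
passes-tooLong zero    (suc y) []          _           = refl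
passes-tooLong (suc x) y       []          _           = refl
passes-tooLong zero    (suc y) (true ∷ p)  _           = refl
passes-tooLong zero    (suc y) (false ∷ p) (s≤s n<y)   = passes-tooLong zero y p n<y
passes-tooLong (suc x) y       (true ∷ p)  (s≤s n<x+y) = passes-tooLong x y p n<x+y
passes-tooLong (suc x) zero    (false ∷ p) _           = refl
passes-tooLong (suc x) (suc y) (false ∷ p) (s≤s n<x+1+y) =
  passes-tooLong (suc x) y p (subst (_<_ _) (+-suc x y) n<x+1+y)

passes-full : ∀ {n} x y (p : Path n) → x + y ≡ n → passes x y p ≡ δ (ups p) x
passes-full zero    zero    []          refl = refl
passes-full zero    (suc y) (true ∷ p)  _    = refl
passes-full zero    (suc y) (false ∷ p) eq   = passes-full zero y p (suc-injective eq)
passes-full (suc x) y       (true ∷ p)  eq   = passes-full x y p (suc-injective eq)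
passes-full (suc x) zero    (false ∷ p) eq   = sym (δ-≢ ups≢x+1)
  where
  ups≢x+1 : ups p ≢ suc x
  ups≢x+1 ups≡x+1 =
    1+n≰n (subst (_≤ _) (trans ups≡x+1 (trans (sym (+-identityʳ (suc x))) eq)) (ups≤length p))
passes-full (suc x) (suc y) (false ∷ p) eq   =
  passes-full (suc x) y p (suc-injective (trans (sym (+-suc (suc x) y)) eq))

-- Started at height c (resp. -(c + 1)), a path is at height 0 exactly after m up-steps and
-- m + c down-steps (resp. m + c + 1 up-steps and m down-steps); any bound K ≥ n on m will do.
mutual
  zerosFrom-+ : ∀ {n K} c (p : Path n) → n ≤ K → zerosFrom (ℤ.+ c) p ≡ ∑[ m ≤ K ] passes m (m + c) p
  zerosFrom-+ {K = K} c [] _ = sym (trans (∑≤-head K _ (λ _ → refl)) (atStart c))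
    where
    atStart : ∀ c → passes 0 (0 + c) [] ≡ zerosFrom (ℤ.+ c) []
    atStart zero    = refl
    atStart (suc c) = refl
  zerosFrom-+ {K = suc K} zero (true ∷ q) (s≤s n≤K) = cong suc (trans (zerosFrom-+ 1 q n≤K)
    (∑≤-cong K λ m → cong (λ y → passes m y q) (+-suc m 0)))
  zerosFrom-+ {K = suc K} (suc c) (true ∷ q) (s≤s n≤K) = trans (zerosFrom-+ (suc c + 1) q n≤K)
    (∑≤-cong K λ m → cong (λ y → passes m y q) (trans (cong (m +_) (+-comm (suc c) 1)) (+-suc m (suc c))))
  zerosFrom-+ {K = suc K} zero (false ∷ q) (s≤s n≤K) = cong suc (trans (zerosFrom-- 0 q n≤K)
    (∑≤-cong K λ m → cong₂ (λ x y → passes x y q) (cong suc (+-identityʳ m)) (sym (+-identityʳ m))))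
  zerosFrom-+ {K = suc K} (suc c) (false ∷ q) (s≤s n≤K) = trans (zerosFrom-+ c q (m≤n⇒m≤1+n n≤K))
    (cong (passes 0 c q +_) (∑≤-cong K λ m → cong (λ y → passes (suc m) y q) (sym (+-suc m c))))

  zerosFrom-- : ∀ {n K} c (p : Path n) → n ≤ K → zerosFrom -[1+ c ] p ≡ ∑[ m ≤ K ] passes (suc (m + c)) m p
  zerosFrom-- {K = K} c [] _ = sym (∑≤-zero K)
  zerosFrom-- {K = suc K} zero (true ∷ q) (s≤s n≤K) = trans (zerosFrom-+ 0 q (m≤n⇒m≤1+n n≤K))
    (cong suc (∑≤-cong K λ m → cong₂ (λ x y → passes x y q) (sym (+-identityʳ (suc m))) (+-identityʳ (suc m))))
  zerosFrom-- {K = suc K} (suc c) (true ∷ q) (s≤s n≤K) = trans (zerosFrom-- c q (m≤n⇒m≤1+n n≤K))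
    (cong (passes (suc c) 0 q +_) (∑≤-cong K λ m → cong (λ x → passes x (suc m) q) (sym (+-suc (suc m) c))))
  zerosFrom-- {K = suc K} c (false ∷ q) (s≤s n≤K) = trans (zerosFrom-- (suc (c + 0)) q n≤K)
    (∑≤-cong K λ m → cong (λ x → passes (suc x) m q) (trans (+-suc m (c + 0)) (cong (suc ∘ (m +_)) (+-identityʳ c))))

zeros≡∑passes : ∀ {n} (p : Path n) → zeros p ≡ ∑[ m ≤ n ] passes m m p
zeros≡∑passes {n} p =
  trans (zerosFrom-+ 0 p ≤-refl) (∑≤-cong n (λ m → cong (λ y → passes m y p) (+-identityʳ m)))

interleavings : ℕ → ℕ → ℕ
interleavings zero    y       = 1
interleavings (suc x) zero    = 1
interleavings (suc x) (suc y) = interleavings x (suc y) + interleavings (suc x) y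

interleavings-* : ∀ x y → interleavings x y * (x ! * y !) ≡ (x + y) !
interleavings-* zero    y       = trans (+-identityʳ _) (*-identityˡ (y !))
interleavings-* (suc x) zero    =
  trans (*-identityˡ _) (trans (*-identityʳ _) (cong _! (sym (+-identityʳ (suc x)))))
interleavings-* (suc x) (suc y) = begin
  (I₁ + I₂) * (suc x * x ! * (suc y * y !))
    ≡⟨ split (suc x) (suc y) (x !) (y !) I₁ I₂ ⟩
  suc x * (I₁ * (x ! * (suc y * y !))) + suc y * (I₂ * (suc x * x ! * y !))
    ≡⟨ cong₂ (λ u v → suc x * u + suc y * v) (interleavings-* x (suc y)) (interleavings-* (suc x) y) ⟩
  suc x * (x + suc y) ! + suc y * (suc x + y) !
    ≡⟨ cong (λ k → suc x * (x + suc y) ! + suc y * k !) (sym (+-suc x y)) ⟩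
  suc x * (x + suc y) ! + suc y * (x + suc y) !
    ≡⟨ *-distribʳ-+ ((x + suc y) !) (suc x) (suc y) ⟨
  (suc x + suc y) ! ∎
  where
  I₁ = interleavings x (suc y)
  I₂ = interleavings (suc x) y
  split : ∀ X Y u v I₁ I₂ → (I₁ + I₂) * (X * u * (Y * v)) ≡ X * (I₁ * (u * (Y * v))) + Y * (I₂ * (X * u * v))
  split = solve-∀

weight : ∀ {n} → (ℕ → ℕ → ℕ) → ℕ → ℕ → Path n → ℕ
weight g a b []          = g a b
weight g a b (true ∷ p)  = weight g (suc a) b p
weight g a b (false ∷ p) = weight g a (suc b) p

weight≡ : ∀ {n} g a b (p : Path n) → weight g a b p ≡ g (a + ups p) (b + downs p)
weight≡ g a b []          = cong₂ g (sym (+-identityʳ a)) (sym (+-identityʳ b))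
weight≡ g a b (true ∷ p)  = trans (weight≡ g (suc a) b p) (cong (λ u → g u (b + downs p)) (sym (+-suc a (ups p))))
weight≡ g a b (false ∷ p) = trans (weight≡ g a (suc b) p) (cong (g (a + ups p)) (sym (+-suc b (downs p))))

weightSum : (ℕ → ℕ → ℕ) → ℕ → ℕ → ℕ → ℕ
weightSum g n a b = sumℕ (map (weight g a b) (allPaths n))

weightThrough : (ℕ → ℕ → ℕ) → ℕ → ℕ → ℕ → ℕ → ℕ → ℕ
weightThrough g n a b x y = sumℕ (map (λ p → weight g a b p * passes x y p) (allPaths n))

weightThrough-prefix : ∀ g {n} a b x y N → x + y + N ≡ n →
                       weightThrough g n a b x y ≡ interleavings x y * weightSum g N (a + x) (b + y)
weightThrough-prefix g a b zero zero N refl = begin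
  sumℕ (map (λ p → weight g a b p * 1) (allPaths N))
    ≡⟨ sum-map-cong (allPaths N) (λ p → *-identityʳ (weight g a b p)) ⟩
  weightSum g N a b
    ≡⟨ cong₂ (weightSum g N) (+-identityʳ a) (+-identityʳ b) ⟨
  weightSum g N (a + 0) (b + 0)
    ≡⟨ +-identityʳ _ ⟨
  1 * weightSum g N (a + 0) (b + 0) ∎
weightThrough-prefix g a b zero (suc y) N refl = begin
  weightThrough g (suc (y + N)) a b 0 (suc y)
    ≡⟨ sum-allPaths-suc (y + N) _ ⟩
  noPaths + weightThrough g (y + N) a (suc b) 0 y
    ≡⟨ cong₂ _+_ noPaths≡0 (weightThrough-prefix g a (suc b) 0 y N refl) ⟩
  1 * weightSum g N (a + 0) (suc b + y)
    ≡⟨ cong (λ b′ → 1 * weightSum g N (a + 0) b′) (sym (+-suc b y)) ⟩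
  1 * weightSum g N (a + 0) (b + suc y) ∎
  where
  noPaths = sumℕ (map (λ q → weight g (suc a) b q * 0) (allPaths (y + N)))
  noPaths≡0 : noPaths ≡ 0
  noPaths≡0 = sum-map-zero (allPaths (y + N)) (λ q → *-zeroʳ (weight g (suc a) b q))
weightThrough-prefix g a b (suc x) zero N refl = begin
  weightThrough g (suc (x + 0 + N)) a b (suc x) 0
    ≡⟨ sum-allPaths-suc (x + 0 + N) _ ⟩
  weightThrough g (x + 0 + N) (suc a) b x 0 + noPaths
    ≡⟨ cong₂ _+_ (weightThrough-prefix g (suc a) b x 0 N refl) noPaths≡0 ⟩
  interleavings x 0 * weightSum g N (suc a + x) (b + 0) + 0
    ≡⟨ cong₂ (λ i a′ → i * weightSum g N a′ (b + 0) + 0) (interleavings-x0 x) (sym (+-suc a x)) ⟩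
  1 * weightSum g N (a + suc x) (b + 0) + 0
    ≡⟨ +-identityʳ _ ⟩
  1 * weightSum g N (a + suc x) (b + 0) ∎
  where
  noPaths = sumℕ (map (λ q → weight g a (suc b) q * 0) (allPaths (x + 0 + N)))
  noPaths≡0 : noPaths ≡ 0
  noPaths≡0 = sum-map-zero (allPaths (x + 0 + N)) (λ q → *-zeroʳ (weight g a (suc b) q))
  interleavings-x0 : ∀ x → interleavings x 0 ≡ 1
  interleavings-x0 zero    = refl
  interleavings-x0 (suc x) = refl
weightThrough-prefix g a b (suc x) (suc y) N refl = begin
  weightThrough g (suc (x + suc y + N)) a b (suc x) (suc y)
    ≡⟨ sum-allPaths-suc (x + suc y + N) _ ⟩
  weightThrough g (x + suc y + N) (suc a) b x (suc y) + weightThrough g (x + suc y + N) a (suc b) (suc x) y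
    ≡⟨ cong₂ _+_ (weightThrough-prefix g (suc a) b x (suc y) N refl)
                 (weightThrough-prefix g a (suc b) (suc x) y N (cong (_+ N) (sym (+-suc x y)))) ⟩
  I₁ * weightSum g N (suc a + x) (b + suc y) + I₂ * weightSum g N (a + suc x) (suc b + y)
    ≡⟨ cong₂ (λ a′ b′ → I₁ * weightSum g N a′ (b + suc y) + I₂ * weightSum g N (a + suc x) b′)
             (sym (+-suc a x)) (sym (+-suc b y)) ⟩
  I₁ * weightSum g N (a + suc x) (b + suc y) + I₂ * weightSum g N (a + suc x) (b + suc y)
    ≡⟨ *-distribʳ-+ _ I₁ I₂ ⟨
  (I₁ + I₂) * weightSum g N (a + suc x) (b + suc y) ∎
  where
  I₁ = interleavings x (suc y)
  I₂ = interleavings (suc x) y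

factorials : ℕ → ℕ → ℕ
factorials a b = a ! * b !

-- The Beta-integral identity Σⱼ C(N,j) (a+j)! (b+N-j)! = a! b! (a+b+N+1)! / (a+b+1)!.
weightSum-factorials : ∀ N a b → (suc (a + b)) ! * weightSum factorials N a b ≡ (suc (a + b + N)) ! * (a ! * b !)
weightSum-factorials zero    a b = cong₂ (λ c s → (suc c) ! * s) (sym (+-identityʳ (a + b))) (+-identityʳ _)
weightSum-factorials (suc N) a b = *-cancelˡ-≡ _ _ (suc (suc (a + b))) (begin
  suc (suc (a + b)) * ((suc (a + b)) ! * weightSum factorials (suc N) a b)
    ≡⟨ cong (λ s → suc (suc (a + b)) * ((suc (a + b)) ! * s)) (sum-allPaths-suc N _) ⟩
  suc (suc (a + b)) * ((suc (a + b)) ! * (Z₁ + Z₂))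
    ≡⟨ distrib (suc (suc (a + b))) ((suc (a + b)) !) Z₁ Z₂ ⟩
  (suc (suc (a + b))) ! * Z₁ + (suc (suc (a + b))) ! * Z₂
    ≡⟨ cong₂ _+_ (weightSum-factorials N (suc a) b) IH₂ ⟩
  G * ((suc a) ! * b !) + G * (a ! * (suc b) !)
    ≡⟨ collect G (suc a) (suc b) (a !) (b !) ⟩
  (suc a + suc b) * (G * (a ! * b !))
    ≡⟨ cong₂ (λ k l → k * (l ! * (a ! * b !))) (cong suc (+-suc a b)) (cong suc (sym (+-suc (a + b) N))) ⟩
  suc (suc (a + b)) * ((suc (a + b + suc N)) ! * (a ! * b !)) ∎)
  where
  Z₁ = weightSum factorials N (suc a) b
  Z₂ = weightSum factorials N a (suc b)
  G  = (suc (suc (a + b + N))) !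
  IH₂ : (suc (suc (a + b))) ! * Z₂ ≡ G * (a ! * (suc b) !)
  IH₂ = subst (λ c → (suc c) ! * Z₂ ≡ (suc (c + N)) ! * (a ! * (suc b) !)) (+-suc a b)
              (weightSum-factorials N a (suc b))
  distrib : ∀ k F Z₁ Z₂ → k * (F * (Z₁ + Z₂)) ≡ k * F * Z₁ + k * F * Z₂
  distrib = solve-∀
  collect : ∀ G X Y A B → G * (X * A * B) + G * (A * (Y * B)) ≡ (X + Y) * (G * (A * B))
  collect = solve-∀

upsCount : ℕ → ℕ → ℕ
upsCount n k = sumℕ (map (λ p → δ (ups p) k) (allPaths n))

upsCount≡interleavings : ∀ {n k} → k ≤ n → upsCount n k ≡ interleavings k (n ∸ k)
upsCount≡interleavings {n} {k} k≤n = begin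
  upsCount n k
    ≡⟨ sum-map-cong (allPaths n) (λ p → sym (weighted p)) ⟩
  weightThrough one n 0 0 k (n ∸ k)
    ≡⟨ weightThrough-prefix one 0 0 k (n ∸ k) 0 (trans (+-identityʳ _) k+[n∸k]≡n) ⟩
  interleavings k (n ∸ k) * 1
    ≡⟨ *-identityʳ _ ⟩
  interleavings k (n ∸ k) ∎
  where
  one : ℕ → ℕ → ℕ
  one _ _ = 1
  k+[n∸k]≡n = m+[n∸m]≡n k≤n
  weighted : ∀ p → weight one 0 0 p * passes k (n ∸ k) p ≡ δ (ups p) k
  weighted p = trans (cong₂ _*_ (weight≡ one 0 0 p) (passes-full k (n ∸ k) p k+[n∸k]≡n)) (*-identityˡ _)

upsCount-* : ∀ {n k} → k ≤ n → upsCount n k * (k ! * (n ∸ k) !) ≡ n !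
upsCount-* {n} {k} k≤n = begin
  upsCount n k * (k ! * (n ∸ k) !)         ≡⟨ cong (_* (k ! * (n ∸ k) !)) (upsCount≡interleavings k≤n) ⟩
  interleavings k (n ∸ k) * (k ! * (n ∸ k) !) ≡⟨ interleavings-* k (n ∸ k) ⟩
  (k + (n ∸ k)) !                          ≡⟨ cong _! (m+[n∸m]≡n k≤n) ⟩
  n ! ∎

returnWeight : ℕ → ℕ → ℕ
returnWeight n m = weightThrough factorials n 0 0 m m

returnWeight-closed : ∀ n m → m + m ≤ n → suc (m + m) * returnWeight n m ≡ (suc n) !
returnWeight-closed n m 2m≤n = *-cancelʳ-≡ _ _ (m ! * m !) {{m !* m !≢0}} (begin
  suc (m + m) * returnWeight n m * (m ! * m !)
    ≡⟨ cong (λ r → suc (m + m) * r * (m ! * m !)) (weightThrough-prefix factorials 0 0 m m N 2m+N≡n) ⟩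
  suc (m + m) * (interleavings m m * Z) * (m ! * m !)
    ≡⟨ regroup (suc (m + m)) (interleavings m m) Z (m ! * m !) ⟩
  suc (m + m) * (interleavings m m * (m ! * m !)) * Z
    ≡⟨ cong (λ f → suc (m + m) * f * Z) (interleavings-* m m) ⟩
  (suc (m + m)) ! * Z
    ≡⟨ weightSum-factorials N m m ⟩
  (suc (m + m + N)) ! * (m ! * m !)
    ≡⟨ cong (λ k → (suc k) ! * (m ! * m !)) 2m+N≡n ⟩
  (suc n) ! * (m ! * m !) ∎)
  where
  N = n ∸ (m + m)
  Z = weightSum factorials N m m
  2m+N≡n = m+[n∸m]≡n 2m≤n
  regroup : ∀ k i z f → k * (i * z) * f ≡ k * (i * f) * z
  regroup = solve-∀

returnWeight-tooFar : ∀ n m → n < m + m → returnWeight n m ≡ 0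
returnWeight-tooFar n m n<2m = sum-map-zero (allPaths n) λ p →
  trans (cong (weight factorials 0 0 p *_) (passes-tooLong m m p n<2m)) (*-zeroʳ (weight factorials 0 0 p))

returnWeight-suc : ∀ n m → returnWeight (suc n) m ≡ suc (suc n) * returnWeight n m + δ (m + m) (suc n) * (suc n) !
returnWeight-suc n m with <-cmp (m + m) (suc n)
... | tri< (s≤s 2m≤n) 2m≢n+1 _ = *-cancelˡ-≡ _ _ (suc (m + m)) (begin
  suc (m + m) * returnWeight (suc n) m
    ≡⟨ returnWeight-closed (suc n) m (m≤n⇒m≤1+n 2m≤n) ⟩
  suc (suc n) * (suc n) !
    ≡⟨ cong (suc (suc n) *_) (returnWeight-closed n m 2m≤n) ⟨
  suc (suc n) * (suc (m + m) * returnWeight n m)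
    ≡⟨ *-leftComm (suc (suc n)) (suc (m + m)) (returnWeight n m) ⟩
  suc (m + m) * (suc (suc n) * returnWeight n m)
    ≡⟨ cong (suc (m + m) *_) (+-identityʳ _) ⟨
  suc (m + m) * (suc (suc n) * returnWeight n m + 0)
    ≡⟨ cong (λ d → suc (m + m) * (suc (suc n) * returnWeight n m + d * (suc n) !)) (δ-≢ 2m≢n+1) ⟨
  suc (m + m) * (suc (suc n) * returnWeight n m + δ (m + m) (suc n) * (suc n) !) ∎)
... | tri≈ _ 2m≡n+1 _ = *-cancelˡ-≡ _ _ (suc (suc n)) (begin
  suc (suc n) * returnWeight (suc n) m
    ≡⟨ cong (λ k → suc k * returnWeight (suc n) m) 2m≡n+1 ⟨
  suc (m + m) * returnWeight (suc n) m
    ≡⟨ returnWeight-closed (suc n) m (≤-reflexive 2m≡n+1) ⟩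
  suc (suc n) * (suc n) !
    ≡⟨ cong (suc (suc n) *_) (cong₂ _+_ (*-zeroʳ (suc (suc n))) (*-identityˡ ((suc n) !))) ⟨
  suc (suc n) * (suc (suc n) * 0 + 1 * (suc n) !)
    ≡⟨ cong₂ (λ r d → suc (suc n) * (suc (suc n) * r + d * (suc n) !)) (returnWeight-tooFar n m n<2m) δ≡1 ⟨
  suc (suc n) * (suc (suc n) * returnWeight n m + δ (m + m) (suc n) * (suc n) !) ∎)
  where
  n<2m : n < m + m
  n<2m = subst (n <_) (sym 2m≡n+1) (n<1+n n)
  δ≡1 : δ (m + m) (suc n) ≡ 1
  δ≡1 = subst (λ k → δ k (suc n) ≡ 1) (sym 2m≡n+1) (δ-refl (suc n))
... | tri> _ 2m≢n+1 n+1<2m = begin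
  returnWeight (suc n) m
    ≡⟨ returnWeight-tooFar (suc n) m n+1<2m ⟩
  0
    ≡⟨ cong (_+ 0 * (suc n) !) (*-zeroʳ (suc (suc n))) ⟨
  suc (suc n) * 0 + 0 * (suc n) !
    ≡⟨ cong₂ (λ r d → suc (suc n) * r + d * (suc n) !)
             (returnWeight-tooFar n m (<-trans (n<1+n n) n+1<2m)) (δ-≢ 2m≢n+1) ⟨
  suc (suc n) * returnWeight n m + δ (m + m) (suc n) * (suc n) ! ∎

∑≤-δ-double : ∀ k N → N ≤ suc (k + k) → ∑[ m ≤ k ] δ (m + m) N ≡ oddInd (suc N)
∑≤-δ-double zero    zero          _ = refl
∑≤-δ-double zero    (suc zero)    _ = refl
∑≤-δ-double zero    (suc (suc N)) (s≤s ())
∑≤-δ-double (suc k) zero          _ = cong suc (∑≤-zero k)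
∑≤-δ-double (suc k) (suc zero)    _ =
  trans (∑≤-cong k (λ m → cong (λ l → δ l 0) (+-suc m m))) (∑≤-zero k)
∑≤-δ-double (suc k) (suc (suc N)) (s≤s (s≤s N≤2k+1)) =
  trans (∑≤-cong k (λ m → cong (λ l → δ l (suc N)) (+-suc m m)))
        (∑≤-δ-double k N (subst (N ≤_) (+-suc k k) N≤2k+1))

HoddNum : ℕ → ℕ
HoddNum zero    = 0
HoddNum (suc M) = suc M * HoddNum M + oddInd (suc M) * M !

∑≤-returnWeight : ∀ n → ∑[ m ≤ n ] returnWeight n m ≡ HoddNum (suc n)
∑≤-returnWeight zero    = refl
∑≤-returnWeight (suc n) = begin
  ∑[ m ≤ suc n ] returnWeight (suc n) m
    ≡⟨ ∑≤-last n (returnWeight (suc n)) ⟩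
  ∑[ m ≤ n ] returnWeight (suc n) m + returnWeight (suc n) (suc n)
    ≡⟨ cong (∑≤ n (returnWeight (suc n)) +_) (returnWeight-tooFar (suc n) (suc n) n+1<2n+2) ⟩
  ∑[ m ≤ n ] returnWeight (suc n) m + 0
    ≡⟨ +-identityʳ _ ⟩
  ∑[ m ≤ n ] returnWeight (suc n) m
    ≡⟨ ∑≤-cong n (returnWeight-suc n) ⟩
  ∑[ m ≤ n ] (suc (suc n) * returnWeight n m + δ (m + m) (suc n) * (suc n) !)
    ≡⟨ ∑≤-+ n _ _ ⟩
  ∑[ m ≤ n ] (suc (suc n) * returnWeight n m) + ∑[ m ≤ n ] (δ (m + m) (suc n) * (suc n) !)
    ≡⟨ cong₂ _+_ (∑≤-*ˡ n (suc (suc n)) _)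
                 (trans (∑≤-cong n (λ m → *-comm _ ((suc n) !))) (∑≤-*ˡ n ((suc n) !) _)) ⟩
  suc (suc n) * ∑[ m ≤ n ] returnWeight n m + (suc n) ! * ∑[ m ≤ n ] δ (m + m) (suc n)
    ≡⟨ cong₂ (λ h o → suc (suc n) * h + (suc n) ! * o)
             (∑≤-returnWeight n) (∑≤-δ-double n (suc n) (s≤s (m≤m+n n n))) ⟩
  suc (suc n) * HoddNum (suc n) + (suc n) ! * oddInd (suc (suc n))
    ≡⟨ cong (suc (suc n) * HoddNum (suc n) +_) (*-comm ((suc n) !) _) ⟩
  HoddNum (suc (suc n)) ∎
  where
  n+1<2n+2 : suc n < suc n + suc n
  n+1<2n+2 = s≤s (subst (n <_) (sym (+-suc n n)) (s≤s (m≤m+n n n)))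

zerosWeight : ℕ → ℕ
zerosWeight n = sumℕ (map (λ p → weight factorials 0 0 p * zeros p) (allPaths n))

zerosWeight≡∑returnWeight : ∀ n → zerosWeight n ≡ ∑[ m ≤ n ] returnWeight n m
zerosWeight≡∑returnWeight n = begin
  zerosWeight n
    ≡⟨ sum-map-cong (allPaths n) (λ p → trans (cong (w p *_) (zeros≡∑passes p)) (sym (∑≤-*ˡ n (w p) _))) ⟩
  sumℕ (map (λ p → ∑[ m ≤ n ] (w p * passes m m p)) (allPaths n))
    ≡⟨ sum-map-∑≤ n (λ p m → w p * passes m m p) (allPaths n) ⟩
  ∑[ m ≤ n ] returnWeight n m ∎
  where
  w : Path n → ℕ
  w = weight factorials 0 0

height : ℕ → ℕ → ℤ
height n k = ℤ.+ (2 * k) ℤ.- ℤ.+ n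

endHeight≡height : ∀ {n} (p : Path n) → endHeight p ≡ height n (ups p)
endHeight≡height []                = refl
endHeight≡height {suc n} (true ∷ p)  = begin
  ℤ.+ 1 ℤ.+ endHeight p                                ≡⟨ cong (ℤ._+_ ℤ.1ℤ) (endHeight≡height p) ⟩
  ℤ.+ 1 ℤ.+ (ℤ.+ (2 * ups p) ℤ.- ℤ.+ n)               ≡⟨ up (ℤ.+ (2 * ups p)) (ℤ.+ n) ⟩
  (ℤ.+ 2 ℤ.+ ℤ.+ (2 * ups p)) ℤ.- (ℤ.+ 1 ℤ.+ ℤ.+ n)  ≡⟨ cong (ℤ._- ℤ.+ suc n) (pos-+ 2 (2 * ups p)) ⟨
  ℤ.+ (2 + 2 * ups p) ℤ.- ℤ.+ suc n                    ≡⟨ cong (λ k → ℤ.+ k ℤ.- ℤ.+ suc n) (*-suc 2 (ups p)) ⟨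
  height (suc n) (suc (ups p)) ∎
  where
  up : ∀ a n → ℤ.+ 1 ℤ.+ (a ℤ.- n) ≡ (ℤ.+ 2 ℤ.+ a) ℤ.- (ℤ.+ 1 ℤ.+ n)
  up = ℤ-Solver.solve-∀
endHeight≡height {suc n} (false ∷ p) =
  trans (cong (ℤ._+_ ℤ.-1ℤ) (endHeight≡height p)) (down (ℤ.+ (2 * ups p)) (ℤ.+ n))
  where
  down : ∀ a n → ℤ.-1ℤ ℤ.+ (a ℤ.- n) ≡ a ℤ.- (ℤ.+ 1 ℤ.+ n)
  down = ℤ-Solver.solve-∀

height-injective : ∀ n {u k} → height n u ≡ height n k → u ≡ k
height-injective n {u} {k} eq = *-cancelˡ-≡ u k 2 (ℤ.+-injective (begin
  ℤ.+ (2 * u)                           ≡⟨ cancel (ℤ.+ (2 * u)) (ℤ.+ n) ⟨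
  height n u ℤ.+ ℤ.+ n                  ≡⟨ cong (ℤ._+ ℤ.+ n) eq ⟩
  height n k ℤ.+ ℤ.+ n                  ≡⟨ cancel (ℤ.+ (2 * k)) (ℤ.+ n) ⟩
  ℤ.+ (2 * k) ∎))
  where
  cancel : ∀ a n → (a ℤ.- n) ℤ.+ n ≡ a
  cancel = ℤ-Solver.solve-∀

endHeight≟height : ∀ {n} k (p : Path n) → does (endHeight p ℤ.≟ height n k) ≡ does (ups p ℕ.≟ k)
endHeight≟height {n} k p = does-⇔ (mk⇔ to from) (endHeight p ℤ.≟ height n k) (ups p ℕ.≟ k)
  where
  to : endHeight p ≡ height n k → ups p ≡ k
  to eq = height-injective n (trans (sym (endHeight≡height p)) eq)
  from : ups p ≡ k → endHeight p ≡ height n k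
  from refl = endHeight≡height p

length-pathsTo : ∀ n k → length (pathsTo n (height n k)) ≡ upsCount n k
length-pathsTo n k = trans (length-filter (λ p → endHeight p ℤ.≟ height n k) (allPaths n))
                           (sum-map-cong (allPaths n) (cong indicator ∘ endHeight≟height k))

zerosAt : ℕ → ℕ → ℕ
zerosAt n k = sumℕ (map (λ p → δ (ups p) k * zeros p) (allPaths n))

sum-zeros-pathsTo : ∀ n k → sumℕ (map zeros (pathsTo n (height n k))) ≡ zerosAt n k
sum-zeros-pathsTo n k = trans
    (sum-map-filter (λ p → endHeight p ℤ.≟ height n k) zeros (allPaths n))
    (sum-map-cong (allPaths n) (λ p → cong (λ b → indicator b * zeros p) (endHeight≟height k p)))

δ-ups*weight : ∀ {n} k (p : Path n) → δ (ups p) k * weight factorials 0 0 p ≡ δ (ups p) k * (k ! * (n ∸ k) !)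
δ-ups*weight {n} k p with ups p ℕ.≟ k
... | yes refl =
  cong (δ (ups p) (ups p) *_) (trans (weight≡ factorials 0 0 p) (cong (λ d → ups p ! * d !) downs≡n∸ups))
  where
  downs≡n∸ups : downs p ≡ n ∸ ups p
  downs≡n∸ups = trans (sym (m+n∸m≡n (ups p) (downs p))) (cong (_∸ ups p) (ups+downs≡length p))
... | no ups≢k =
  trans (cong (_* weight factorials 0 0 p) (δ-≢ ups≢k)) (cong (_* (k ! * (n ∸ k) !)) (sym (δ-≢ ups≢k)))

zerosWeightAt : ℕ → ℕ → ℕ
zerosWeightAt n k = sumℕ (map (λ p → δ (ups p) k * (weight factorials 0 0 p * zeros p)) (allPaths n))

zerosAt-* : ∀ n k → zerosAt n k * (k ! * (n ∸ k) !) ≡ zerosWeightAt n k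
zerosAt-* n k = begin
  zerosAt n k * c
    ≡⟨ *-comm (zerosAt n k) c ⟩
  c * zerosAt n k
    ≡⟨ sum-map-*ˡ c (λ p → δ (ups p) k * zeros p) (allPaths n) ⟨
  sumℕ (map (λ p → c * (δ (ups p) k * zeros p)) (allPaths n))
    ≡⟨ sum-map-cong (allPaths n) pointwise ⟩
  zerosWeightAt n k ∎
  where
  c = k ! * (n ∸ k) !
  pointwise : ∀ p → c * (δ (ups p) k * zeros p) ≡ δ (ups p) k * (weight factorials 0 0 p * zeros p)
  pointwise p = begin
    c * (δ (ups p) k * zeros p)                   ≡⟨ *-leftComm c (δ (ups p) k) (zeros p) ⟩
    δ (ups p) k * (c * zeros p)                   ≡⟨ *-assoc (δ (ups p) k) c _ ⟨
    δ (ups p) k * c * zeros p                     ≡⟨ cong (_* zeros p) (δ-ups*weight k p) ⟨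
    δ (ups p) k * weight factorials 0 0 p * zeros p ≡⟨ *-assoc (δ (ups p) k) _ _ ⟩
    δ (ups p) k * (weight factorials 0 0 p * zeros p) ∎

∑≤-zerosWeightAt : ∀ n → ∑[ k ≤ n ] zerosWeightAt n k ≡ zerosWeight n
∑≤-zerosWeightAt n = begin
  ∑[ k ≤ n ] zerosWeightAt n k
    ≡⟨ sum-map-∑≤ n (λ p k → δ (ups p) k * (weight factorials 0 0 p * zeros p)) (allPaths n) ⟨
  sumℕ (map (λ p → ∑[ k ≤ n ] (δ (ups p) k * (weight factorials 0 0 p * zeros p))) (allPaths n))
    ≡⟨ sum-map-cong (allPaths n) pointwise ⟩
  zerosWeight n ∎
  where
  pointwise : ∀ p → ∑[ k ≤ n ] (δ (ups p) k * (weight factorials 0 0 p * zeros p))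
                    ≡ weight factorials 0 0 p * zeros p
  pointwise p = begin
    ∑[ k ≤ n ] (δ (ups p) k * x)  ≡⟨ ∑≤-cong n (λ k → *-comm (δ (ups p) k) x) ⟩
    ∑[ k ≤ n ] (x * δ (ups p) k)  ≡⟨ ∑≤-*ˡ n x (δ (ups p)) ⟩
    x * ∑[ k ≤ n ] δ (ups p) k    ≡⟨ cong (x *_) (∑≤-δ n (ups≤length p)) ⟩
    x * 1                         ≡⟨ *-identityʳ x ⟩
    x ∎
    where x = weight factorials 0 0 p * zeros p

fromℚᵘ-homo-+ : ∀ p q → fromℚᵘ p ℚ.+ fromℚᵘ q ≡ fromℚᵘ (p ℚᵘ.+ q)
fromℚᵘ-homo-+ p q = toℚᵘ-injective (≃-trans (toℚᵘ-homo-+ (fromℚᵘ p) (fromℚᵘ q))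
  (≃-trans (ℚᵘ.+-cong (toℚᵘ-fromℚᵘ p) (toℚᵘ-fromℚᵘ q)) (≃-sym (toℚᵘ-fromℚᵘ (p ℚᵘ.+ q)))))

fromℚᵘ-homo-* : ∀ p q → fromℚᵘ p ℚ.* fromℚᵘ q ≡ fromℚᵘ (p ℚᵘ.* q)
fromℚᵘ-homo-* p q = toℚᵘ-injective (≃-trans (toℚᵘ-homo-* (fromℚᵘ p) (fromℚᵘ q))
  (≃-trans (ℚᵘ.*-cong (toℚᵘ-fromℚᵘ p) (toℚᵘ-fromℚᵘ q)) (≃-sym (toℚᵘ-fromℚᵘ (p ℚᵘ.* q)))))

÷ℕ-+ : ∀ a c d .{{_ : ℕ.NonZero d}} → a ÷ℕ d ℚ.+ c ÷ℕ d ≡ (a + c) ÷ℕ d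
÷ℕ-+ a c (suc d) = trans (fromℚᵘ-homo-+ (mkℚᵘ (ℤ.+ a) d) (mkℚᵘ (ℤ.+ c) d))
                         (fromℚᵘ-cong {mkℚᵘ (ℤ.+ a) d ℚᵘ.+ mkℚᵘ (ℤ.+ c) d} {mkℚᵘ (ℤ.+ (a + c)) d} (*≡* cross))
  where
  collect : ∀ a c e → (a ℤ.* e ℤ.+ c ℤ.* e) ℤ.* e ≡ (a ℤ.+ c) ℤ.* (e ℤ.* e)
  collect = ℤ-Solver.solve-∀
  cross : (ℤ.+ a ℤ.* ℤ.+ suc d ℤ.+ ℤ.+ c ℤ.* ℤ.+ suc d) ℤ.* ℤ.+ suc d ≡ ℤ.+ (a + c) ℤ.* ℤ.+ (suc d * suc d)
  cross = begin
    (ℤ.+ a ℤ.* ℤ.+ suc d ℤ.+ ℤ.+ c ℤ.* ℤ.+ suc d) ℤ.* ℤ.+ suc d ≡⟨ collect (ℤ.+ a) (ℤ.+ c) (ℤ.+ suc d) ⟩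
    (ℤ.+ a ℤ.+ ℤ.+ c) ℤ.* (ℤ.+ suc d ℤ.* ℤ.+ suc d)         ≡⟨ cong₂ ℤ._*_ (pos-+ a c) (pos-* (suc d) (suc d)) ⟨
    ℤ.+ (a + c) ℤ.* ℤ.+ (suc d * suc d)                       ∎

÷ℕ-* : ∀ a b c d .{{_ : ℕ.NonZero b}} .{{_ : ℕ.NonZero d}} → (a ÷ℕ b) ℚ.* (c ÷ℕ d) ≡ (a * c) ÷ℕ (b * d)
÷ℕ-* a (suc b) c (suc d) =
  trans (fromℚᵘ-homo-* (mkℚᵘ (ℤ.+ a) b) (mkℚᵘ (ℤ.+ c) d)) (cong (λ z → fromℚᵘ (mkℚᵘ z _)) (sym (pos-* a c)))

÷ℕ-cong : ∀ a b c d .{{_ : ℕ.NonZero b}} .{{_ : ℕ.NonZero d}} → a * d ≡ c * b → a ÷ℕ b ≡ c ÷ℕ d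
÷ℕ-cong a (suc b) c (suc d) ad≡cb =
  fromℚᵘ-cong {mkℚᵘ (ℤ.+ a) b} {mkℚᵘ (ℤ.+ c) d}
              (*≡* (trans (sym (pos-* a (suc d))) (trans (cong ℤ.+_ ad≡cb) (pos-* c (suc b)))))

sumℚ-applyUpTo : ∀ n (f : ℕ → ℚ) (g : ℕ → ℕ) d .{{_ : ℕ.NonZero d}} → (∀ k → k ≤ n → f k ≡ g k ÷ℕ d) →
                 sumℚ (applyUpTo f (suc n)) ≡ (∑≤ n g) ÷ℕ d
sumℚ-applyUpTo zero    f g d f≗g÷d = trans (ℚ.+-identityʳ (f 0)) (f≗g÷d 0 z≤n)
sumℚ-applyUpTo (suc n) f g d f≗g÷d = trans (cong₂ ℚ._+_ (f≗g÷d 0 z≤n) tail) (÷ℕ-+ (g 0) (∑≤ n (g ∘ suc)) d)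
  where
  tail = sumℚ-applyUpTo n (f ∘ suc) (g ∘ suc) d (λ k k≤n → f≗g÷d (suc k) (s≤s k≤n))

Hodd≡HoddNum÷! : ∀ M → Hodd M ≡ HoddNum M ÷ℕ (M !)
Hodd≡HoddNum÷! zero    = refl
Hodd≡HoddNum÷! (suc M) = begin
  Hodd M ℚ.+ o ÷ℕ suc M
    ≡⟨ cong₂ ℚ._+_ (trans (Hodd≡HoddNum÷! M)
                          (÷ℕ-cong (HoddNum M) (M !) (suc M * HoddNum M) ((suc M) !) {{M !≢0}} {{(suc M) !≢0}} old))
                   (÷ℕ-cong o (suc M) (o * M !) ((suc M) !) {{_}} {{(suc M) !≢0}} new) ⟩
  (suc M * HoddNum M) ÷ℕ ((suc M) !) ℚ.+ (o * M !) ÷ℕ ((suc M) !)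
    ≡⟨ ÷ℕ-+ (suc M * HoddNum M) (o * M !) ((suc M) !) {{(suc M) !≢0}} ⟩
  HoddNum (suc M) ÷ℕ ((suc M) !) ∎
  where
  o = oddInd (suc M)
  old : HoddNum M * (suc M) ! ≡ suc M * HoddNum M * M !
  old = trans (*-leftComm (HoddNum M) (suc M) (M !)) (sym (*-assoc (suc M) (HoddNum M) (M !)))
  new : o * (suc M) ! ≡ o * M ! * suc M
  new = trans (cong (o *_) (*-comm (suc M) (M !))) (sym (*-assoc o (M !) (suc M)))

contribution : ℕ → ℤ → ℚ
contribution n D = (1 ÷ℕ suc n) ℚ.* (sumℕ (map zeros (pathsTo n D)) ÷ℕ length (pathsTo n D))

contribution-height : ∀ n k → k ≤ n → contribution n (height n k) ≡ zerosWeightAt n k ÷ℕ ((suc n) !)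
contribution-height n k k≤n = begin
  contribution n (height n k)
    ≡⟨ cong₂ (λ a c → (1 ÷ℕ suc n) ℚ.* (a ÷ℕ c)) (sum-zeros-pathsTo n k) (length-pathsTo n k) ⟩
  (1 ÷ℕ suc n) ℚ.* (A ÷ℕ C)
    ≡⟨ ÷ℕ-* 1 (suc n) A C {{_}} {{C≢0}} ⟩
  (1 * A) ÷ℕ (suc n * C)
    ≡⟨ ÷ℕ-cong (1 * A) (suc n * C) _ _ {{m*n≢0 (suc n) C {{_}} {{C≢0}}}} {{(suc n) !≢0}} cross ⟩
  zerosWeightAt n k ÷ℕ ((suc n) !) ∎
  where
  A = zerosAt n k
  C = upsCount n k
  w = k ! * (n ∸ k) !
  C≢0 : ℕ.NonZero C
  C≢0 = m*n≢0⇒m≢0 C {{subst ℕ.NonZero (sym (upsCount-* k≤n)) (n !≢0)}}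
  cross : 1 * A * (suc n) ! ≡ zerosWeightAt n k * (suc n * C)
  cross = begin
    1 * A * (suc n * n !)          ≡⟨ cong (λ f → 1 * A * (suc n * f)) (upsCount-* k≤n) ⟨
    1 * A * (suc n * (C * w))      ≡⟨ regroup A (suc n) C w ⟩
    A * w * (suc n * C)            ≡⟨ cong (_* (suc n * C)) (zerosAt-* n k) ⟩
    zerosWeightAt n k * (suc n * C) ∎
    where
    regroup : ∀ a m c w → 1 * a * (m * (c * w)) ≡ a * w * (m * c)
    regroup = solve-∀

theorem6p1 : (n : ℕ) → expectedZeros n ≡ Hodd (suc n)
theorem6p1 n = begin
  expectedZeros n
    ≡⟨ cong sumℚ (map-∘ {g = contribution n} {f = height n} (List.upTo (suc n))) ⟨
  sumℚ (map (contribution n ∘ height n) (List.upTo (suc n)))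
    ≡⟨ cong sumℚ (map-upTo (contribution n ∘ height n) (suc n)) ⟩
  sumℚ (applyUpTo (contribution n ∘ height n) (suc n))
    ≡⟨ sumℚ-applyUpTo n _ (zerosWeightAt n) ((suc n) !) {{(suc n) !≢0}} (contribution-height n) ⟩
  (∑[ k ≤ n ] zerosWeightAt n k) ÷ℕ ((suc n) !)
    ≡⟨ cong (_÷ℕ ((suc n) !)) (∑≤-zerosWeightAt n) ⟩
  zerosWeight n ÷ℕ ((suc n) !)
    ≡⟨ cong (_÷ℕ ((suc n) !)) (trans (zerosWeight≡∑returnWeight n) (∑≤-returnWeight n)) ⟩
  HoddNum (suc n) ÷ℕ ((suc n) !)
    ≡⟨ Hodd≡HoddNum÷! (suc n) ⟨
  Hodd (suc n) ∎
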